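{- Let $G$ be a graph such that $V(G)$ is partitioned into maximal modules $S_1,\dots,S_m$. Assume every proper induced subgraph of $G$ is recolorable. Let $\alpha$ and $\beta$ be two $\chi$-colorings of $G$ such that $\alpha(S_p)\subseteq\beta(S_p)$ for every $p\in[m]$. Then there is a path between $\alpha$ and $\beta$ in $R_\ell(G)$ for every $\ell\ge\chi(G)+1$.
   Context: Graphs are finite and simple. A $k$-coloring of $G$ is a map $V(G)\to\{1,\dots,k\}$ giving adjacent vertices different colors; $\chi(G)$ is the chromatic number, and a $\chi$-coloring is a $\chi(G)$-coloring, regarded (for $\ell\ge\chi(G)$) as a vertex of $R_\ell(G)$. $R_\ell(G)$ is the graph whose vertices are the $\ell$-colorings of $G$, two adjacent if they differ on exactly one vertex. $G$ is recolorable if $R_\ell(G)$ is connected for every $\ell\ge\chi(G)+1$. For a coloring $\gamma$ and $S\subseteq V(G)$, $\gamma(S)$ is the set of colors used on $S$. A module is a non-empty $S\subseteq V(G)$ such that every vertex outside $S$ is adjacent to all or none of $S$; a maximal module is a module $S\subsetneq V(G)$ not contained in any larger module properly contained in $V(G)$. -}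

module Defs where

open import Data.Nat using (ℕ; suc; _≤_; _<_)
open import Data.Fin using (Fin; inject≤)
open import Data.Bool using (Bool; true; false)
open import Data.Vec using (Vec; lookup; map)
open import Data.Product using (Σ; ∃; _×_; _,_)
open import Data.Sum using (_⊎_)
open import Relation.Nullary using (¬_)
open import Relation.Binary.PropositionalEquality using (_≡_; _≢_)
open import Relation.Binary.Construct.Closure.ReflexiveTransitive using (Star)
open import Function.Definitions using (Injective)

record Graph (n : ℕ) : Set where
  field
    adj   : Fin n → Fin n → Bool
    sym   : ∀ u v → adj u v ≡ adj v u
    irrfl : ∀ v → adj v v ≡ false
open Graph public

Adjacent : ∀ {n} → Graph n → Fin n → Fin n → Set
Adjacent G u v = adj G u v ≡ true

Colouring : ℕ → ℕ → Set
Colouring n k = Vec (Fin k) n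

Proper : ∀ {n k} → Graph n → Colouring n k → Set
Proper G γ = ∀ u v → Adjacent G u v → lookup γ u ≢ lookup γ v

IsChromatic : ∀ {n} → Graph n → ℕ → Set
IsChromatic {n} G c =
  (Σ (Colouring n c) (Proper G)) × (∀ k → (γ : Colouring n k) → Proper G γ → c ≤ k)

REdge : ∀ {n} (G : Graph n) (ℓ : ℕ) → Colouring n ℓ → Colouring n ℓ → Set
REdge G ℓ γ δ = Proper G γ × Proper G δ ×
  (∃ λ v → lookup γ v ≢ lookup δ v × (∀ u → u ≢ v → lookup γ u ≡ lookup δ u))

RPath : ∀ {n} (G : Graph n) (ℓ : ℕ) → Colouring n ℓ → Colouring n ℓ → Set
RPath G ℓ = Star (REdge G ℓ)

RConnected : ∀ {n} → Graph n → ℕ → Set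
RConnected {n} G ℓ = (α β : Colouring n ℓ) → Proper G α → Proper G β → RPath G ℓ α β

Recolourable : ∀ {n} → Graph n → Set
Recolourable G = ∀ c → IsChromatic G c → ∀ ℓ → suc c ≤ ℓ → RConnected G ℓ

Induced : ∀ {n k} → Graph n → (Fin k → Fin n) → Graph k
Induced G f = record
  { adj = λ i j → adj G (f i) (f j)
  ; sym = λ i j → sym G (f i) (f j)
  ; irrfl = λ i → irrfl G (f i) }

ProperInducedRecolourable : ∀ {n} → Graph n → Set
ProperInducedRecolourable {n} G =
  ∀ k → k < n → (f : Fin k → Fin n) → Injective _≡_ _≡_ f → Recolourable (Induced G f)

VSet : ℕ → Set₁
VSet n = Fin n → Set

IsModule : ∀ {n} → Graph n → VSet n → Set
IsModule {n} G S = (∃ λ v → S v) ×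
  (∀ x → ¬ S x → (∀ y → S y → Adjacent G x y) ⊎ (∀ y → S y → ¬ Adjacent G x y))

ProperSubset : ∀ {n} → VSet n → Set
ProperSubset S = ∃ λ v → ¬ S v

IsMaximalModule : ∀ {n} → Graph n → VSet n → Set₁
IsMaximalModule {n} G S = IsModule G S × ProperSubset S ×
  ((T : VSet n) → IsModule G T → ProperSubset T → (∀ v → S v → T v) → ∀ v → T v → S v)

-- Partition of V(G) into blocks S_1..S_m given by part : V(G) → [m]; S_p = part⁻¹(p).
Block : ∀ {n m} → (Fin n → Fin m) → Fin m → VSet n
Block part p v = part v ≡ p

lift : ∀ {n c ℓ} → c ≤ ℓ → Colouring n c → Colouring n ℓ
lift c≤ℓ = map (λ i → inject≤ i c≤ℓ)

{-# OPTIONS --safe #-}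
-- Turn α into β one block at a time. Every intermediate colouring (β on the blocks
-- already treated, α on the others) is proper and, by α(S_p) ⊆ β(S_p), gives each
-- vertex of S_p a colour of β(S_p). Two adjacent blocks are modules, hence completely
-- joined, so β uses disjoint colour sets on them; thus while S_p is recoloured no
-- outside neighbour carries a colour of β(S_p), nor the colour c, which β never uses.
-- So S_p can be recoloured freely inside the palette β(S_p) ∪ {c}, which has one more
-- colour than χ(G[S_p]) ≤ |β(S_p)|, and G[S_p] is recolourable.
module Submission where

open import Defs hiding (sym)
open import Data.Nat using (ℕ; zero; suc; _≤_; _<_; _<ᵇ_; s≤s)
open import Data.Nat.Properties using (<⇒≤; <⇒≢; ≤-refl; ≮⇒≥; m<1+n⇒m<n∨m≡n; <⇒<ᵇ)
open import Data.Fin using (Fin; zero; suc; toℕ; fromℕ<; inject≤; punchOut)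
open import Data.Fin.Properties
  using (suc-injective; toℕ<n; toℕ-inject≤; toℕ-fromℕ<; toℕ-injective; inject≤-injective;
         punchOut-injective; injective⇒≤; any?; all?; _≟_)
open import Data.Bool using (true; false; if_then_else_)
open import Data.Bool.Properties using (T-≡)
import Data.Bool as Bool
open import Data.Vec using (Vec; []; _∷_; lookup; tabulate; map)
open import Data.Vec.Properties using (lookup-map; lookup∘tabulate; tabulate∘lookup; tabulate-cong)
open import Data.Product using (Σ; ∃; _×_; _,_; proj₁; proj₂)
open import Data.Sum using (_⊎_; inj₁; inj₂; [_,_]′)
open import Function using (_∘_)
open import Function.Bundles using (Equivalence)
open import Function.Definitions using (Injective)
open import Level using (0ℓ)
open import Relation.Nullary using (¬_; yes; no; contradiction)
open import Relation.Nullary.Decidable using (Dec; map′; ¬?; _×-dec_; _→-dec_)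
open import Relation.Unary using (Pred; Decidable)
open import Relation.Binary.PropositionalEquality
  using (_≡_; _≢_; refl; sym; trans; cong; subst; subst₂; module ≡-Reasoning)
open import Relation.Binary.Construct.Closure.ReflexiveTransitive using (ε; _◅◅_; gmap)

record Enumeration {N : ℕ} (P : Pred (Fin N) 0ℓ) : Set where
  field
    size            : ℕ
    embed           : Fin size → Fin N
    embed-injective : Injective _≡_ _≡_ embed
    embed∈          : ∀ i → P (embed i)
    index           : ∀ {x} → P x → Fin size
    embed∘index     : ∀ {x} (px : P x) → embed (index px) ≡ x

  index∘embed : ∀ {i} (px : P (embed i)) → index px ≡ i
  index∘embed px = embed-injective (embed∘index px)

module _ {N : ℕ} {P : Pred (Fin (suc N)) 0ℓ} (E : Enumeration (P ∘ suc)) where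
  open Enumeration E

  enumerate-with-zero : P zero → Enumeration P
  enumerate-with-zero p₀ = record
    { size = suc size ; embed = embed′ ; embed-injective = injective
    ; embed∈ = embed′∈ ; index = index′ ; embed∘index = embed′∘index′ }
    where
    embed′ : Fin (suc size) → Fin (suc N)
    embed′ zero    = zero
    embed′ (suc i) = suc (embed i)

    injective : Injective _≡_ _≡_ embed′
    injective {zero}  {zero}  _  = refl
    injective {suc i} {suc j} eq = cong suc (embed-injective (suc-injective eq))

    embed′∈ : ∀ i → P (embed′ i)
    embed′∈ zero    = p₀
    embed′∈ (suc i) = embed∈ i

    index′ : ∀ {x} → P x → Fin (suc size)
    index′ {zero}  _  = zero
    index′ {suc x} px = suc (index px)

    embed′∘index′ : ∀ {x} (px : P x) → embed′ (index′ px) ≡ x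
    embed′∘index′ {zero}  _  = refl
    embed′∘index′ {suc x} px = cong suc (embed∘index px)

  enumerate-without-zero : ¬ P zero → Enumeration P
  enumerate-without-zero ¬p₀ = record
    { size = size ; embed = suc ∘ embed ; embed-injective = embed-injective ∘ suc-injective
    ; embed∈ = embed∈ ; index = index′ ; embed∘index = embed∘index′ }
    where
    index′ : ∀ {x} → P x → Fin size
    index′ {zero}  p₀ = contradiction p₀ ¬p₀
    index′ {suc x} px = index px

    embed∘index′ : ∀ {x} (px : P x) → suc (embed (index′ px)) ≡ x
    embed∘index′ {zero}  p₀ = contradiction p₀ ¬p₀
    embed∘index′ {suc x} px = cong suc (embed∘index px)

enumerate : ∀ {N} {P : Pred (Fin N) 0ℓ} → Decidable P → Enumeration P
enumerate {zero}  P? = record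
  { size = 0 ; embed = λ () ; embed-injective = λ {} ; embed∈ = λ ()
  ; index = λ {} ; embed∘index = λ {} }
enumerate {suc N} P? with P? zero
... | yes p₀  = enumerate-with-zero (enumerate (P? ∘ suc)) p₀
... | no  ¬p₀ = enumerate-without-zero (enumerate (P? ∘ suc)) ¬p₀

size< : ∀ {N} {P : Pred (Fin N) 0ℓ} (E : Enumeration P) {x : Fin N} →
        ¬ P x → Enumeration.size E < N
size< {suc N} E {x} ¬px = s≤s (injective⇒≤ punched-injective)
  where
  open Enumeration E
  x≢embed : ∀ i → x ≢ embed i
  x≢embed i eq = ¬px (subst _ (sym eq) (embed∈ i))

  punched-injective : Injective _≡_ _≡_ (λ i → punchOut (x≢embed i))
  punched-injective = embed-injective ∘ punchOut-injective (x≢embed _) (x≢embed _)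

module _ {P : Pred ℕ 0ℓ} (P? : Decidable P) where

  least-below : ∀ k → (∀ j → j < k → ¬ P j) ⊎ ∃ λ c → P c × (∀ j → j < c → ¬ P j)
  least-below zero = inj₁ λ _ ()
  least-below (suc k) with least-below k
  ... | inj₂ found = inj₂ found
  ... | inj₁ none with P? k
  ...   | yes pk  = inj₂ (k , pk , none)
  ...   | no  ¬pk = inj₁ λ j j<1+k →
    [ none j , (λ { refl → ¬pk }) ]′ (m<1+n⇒m<n∨m≡n j<1+k)

  least : ∀ {k} → P k → ∃ λ c → P c × (∀ j → j < c → ¬ P j)
  least {k} pk with least-below (suc k)
  ... | inj₁ none  = contradiction pk (none k ≤-refl)
  ... | inj₂ found = found

any-vector? : ∀ {k} s {P : Pred (Vec (Fin k) s) 0ℓ} → Decidable P → Dec (∃ P)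
any-vector? zero    P? = map′ ([] ,_) (λ { ([] , p) → p }) (P? [])
any-vector? (suc s) P? =
  map′ (λ (x , xs , p) → x ∷ xs , p) (λ { (x ∷ xs , p) → x , xs , p })
       (any? λ x → any-vector? s (P? ∘ (x ∷_)))

Colourable : ∀ {n} → Graph n → ℕ → Set
Colourable {n} G k = Σ (Colouring n k) (Proper G)

proper? : ∀ {n k} (G : Graph n) → Decidable (Proper {n} {k} G)
proper? G γ = all? λ u → all? λ v →
  (adj G u v Bool.≟ true) →-dec ¬? (lookup γ u ≟ lookup γ v)

colourable? : ∀ {n} (G : Graph n) → Decidable (Colourable G)
colourable? {n} G _ = any-vector? n (proper? G)

chromatic-number : ∀ {n k} (G : Graph n) (γ : Colouring n k) → Proper G γ →
                   ∃ λ c → c ≤ k × IsChromatic G c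
chromatic-number {k = k} G γ γ-proper with least (colourable? G) (γ , γ-proper)
... | c , colourable , fewer-impossible =
  c , ≮⇒≥ (λ k<c → fewer-impossible k k<c (γ , γ-proper)) ,
  colourable , λ k δ δ-proper → ≮⇒≥ (λ k<c → fewer-impossible k k<c (δ , δ-proper))

map-proper : ∀ {n k k′} (G : Graph n) {f : Fin k → Fin k′} → Injective _≡_ _≡_ f →
             (γ : Colouring n k) → Proper G γ → Proper G (map f γ)
map-proper G {f} f-injective γ γ-proper u v adj eq =
  γ-proper u v adj (f-injective (trans (sym (lookup-map u f γ)) (trans eq (lookup-map v f γ))))

lookup-lift : ∀ {n c ℓ} (c≤ℓ : c ≤ ℓ) (γ : Colouring n c) v →
              lookup (lift c≤ℓ γ) v ≡ inject≤ (lookup γ v) c≤ℓ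
lookup-lift c≤ℓ γ v = lookup-map v _ γ

lift-proper : ∀ {n c ℓ} (G : Graph n) (c≤ℓ : c ≤ ℓ) (γ : Colouring n c) →
              Proper G γ → Proper G (lift c≤ℓ γ)
lift-proper G c≤ℓ = map-proper G (inject≤-injective c≤ℓ c≤ℓ _ _)

lift-avoids-top : ∀ {n c ℓ} (c<ℓ : c < ℓ) (γ : Colouring n c) v →
                  lookup (lift (<⇒≤ c<ℓ) γ) v ≢ fromℕ< c<ℓ
lift-avoids-top {c = c} c<ℓ γ v eq = <⇒≢ (toℕ<n (lookup γ v)) (begin
  toℕ (lookup γ v)                              ≡⟨ toℕ-inject≤ (lookup γ v) (<⇒≤ c<ℓ) ⟨
  toℕ (inject≤ (lookup γ v) (<⇒≤ c<ℓ))          ≡⟨ cong toℕ (lookup-lift (<⇒≤ c<ℓ) γ v) ⟨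
  toℕ (lookup (lift (<⇒≤ c<ℓ) γ) v)             ≡⟨ cong toℕ eq ⟩
  toℕ (fromℕ< c<ℓ)                              ≡⟨ toℕ-fromℕ< c<ℓ ⟩
  c                                             ∎)
  where open ≡-Reasoning

adjacent-sym : ∀ {n} (G : Graph n) {u v} → Adjacent G u v → Adjacent G v u
adjacent-sym G {u} {v} adj = trans (Graph.sym G v u) adj

module-adjacent-to-all : ∀ {n} (G : Graph n) {S : VSet n} → IsModule G S →
  ∀ {x y y′} → ¬ S x → S y → Adjacent G x y → S y′ → Adjacent G x y′
module-adjacent-to-all G (_ , uniform) {x} {y} x∉S y∈S adj y′∈S with uniform x x∉S
... | inj₁ adjacent-to-all  = adjacent-to-all _ y′∈S
... | inj₂ adjacent-to-none = contradiction adj (adjacent-to-none y y∈S)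

disjoint-modules-joined : ∀ {n} (G : Graph n) {S T : VSet n} →
  IsModule G S → IsModule G T → (∀ {x} → S x → ¬ T x) →
  ∀ {u v u′ v′} → S u → T v → Adjacent G u v → S u′ → T v′ → Adjacent G u′ v′
disjoint-modules-joined G {S} {T} S-module T-module disjoint {u} {v} {u′}
  u∈S v∈T adj u′∈S v′∈T =
  module-adjacent-to-all G T-module (disjoint u′∈S) v∈T (adjacent-sym G v~u′) v′∈T
  where
  v~u′ : Adjacent G v u′
  v~u′ = module-adjacent-to-all G S-module (λ v∈S → disjoint v∈S v∈T) u∈S
           (adjacent-sym G adj) u′∈S

module Recolouring {n ℓ} (G : Graph n) {S : VSet n} (S? : Decidable S)
  {P : Pred (Fin ℓ) 0ℓ} (P? : Decidable P) (spare : Fin ℓ) (spare∉P : ¬ P spare) where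

  vertices : Enumeration S
  vertices = enumerate S?

  colours : Enumeration P
  colours = enumerate P?

  module V = Enumeration vertices
  module C = Enumeration colours

  H : Graph V.size
  H = Induced G V.embed

  palette : Fin (suc C.size) → Fin ℓ
  palette zero    = spare
  palette (suc i) = C.embed i

  palette-injective : Injective _≡_ _≡_ palette
  palette-injective {zero}  {zero}  _  = refl
  palette-injective {zero}  {suc j} eq = contradiction (subst P (sym eq) (C.embed∈ j)) spare∉P
  palette-injective {suc i} {zero}  eq = contradiction (subst P eq (C.embed∈ i)) spare∉P
  palette-injective {suc i} {suc j} eq = cong suc (C.embed-injective eq)

  palette-avoids : ∀ {x} → x ≢ spare → ¬ P x → ∀ i → palette i ≢ x
  palette-avoids x≢spare _   zero    eq = x≢spare (sym eq)
  palette-avoids _       x∉P (suc i) eq = x∉P (subst P eq (C.embed∈ i))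

  PaletteOnS : Colouring n ℓ → Set
  PaletteOnS γ = ∀ {v} → S v → P (lookup γ v)

  Shielded : Colouring n ℓ → Set
  Shielded γ = ∀ {u v} → Adjacent G u v → S u → ¬ S v → lookup γ v ≢ spare × ¬ P (lookup γ v)

  restrict : (γ : Colouring n ℓ) → PaletteOnS γ → Colouring V.size C.size
  restrict γ γ∈P = tabulate λ i → C.index (γ∈P (V.embed∈ i))

  embed-restrict : ∀ γ (γ∈P : PaletteOnS γ) i →
                   C.embed (lookup (restrict γ γ∈P) i) ≡ lookup γ (V.embed i)
  embed-restrict γ γ∈P i = trans (cong C.embed (lookup∘tabulate _ i)) (C.embed∘index _)

  restrict-proper : ∀ γ (γ∈P : PaletteOnS γ) → Proper G γ → Proper H (restrict γ γ∈P)
  restrict-proper γ γ∈P γ-proper u v adj eq = γ-proper _ _ adj (begin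
    lookup γ (V.embed u)                  ≡⟨ sym (embed-restrict γ γ∈P u) ⟩
    C.embed (lookup (restrict γ γ∈P) u)   ≡⟨ cong C.embed eq ⟩
    C.embed (lookup (restrict γ γ∈P) v)   ≡⟨ embed-restrict γ γ∈P v ⟩
    lookup γ (V.embed v)                  ∎)
    where open ≡-Reasoning

  extendAt : Colouring n ℓ → Colouring V.size (suc C.size) → Fin n → Fin ℓ
  extendAt γ δ v with S? v
  ... | yes v∈S = palette (lookup δ (V.index v∈S))
  ... | no  _   = lookup γ v

  extend : Colouring n ℓ → Colouring V.size (suc C.size) → Colouring n ℓ
  extend γ δ = tabulate (extendAt γ δ)

  lookup-extend-embed : ∀ γ δ i → lookup (extend γ δ) (V.embed i) ≡ palette (lookup δ i)
  lookup-extend-embed γ δ i = trans (lookup∘tabulate _ (V.embed i)) extendAt-embed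
    where
    extendAt-embed : extendAt γ δ (V.embed i) ≡ palette (lookup δ i)
    extendAt-embed with S? (V.embed i)
    ... | yes i∈S = cong (palette ∘ lookup δ) (V.index∘embed i∈S)
    ... | no  i∉S = contradiction (V.embed∈ i) i∉S

  extendAt-proper : ∀ {γ δ} → Proper G γ → Shielded γ → Proper H δ →
                    ∀ {u v} → Adjacent G u v → extendAt γ δ u ≢ extendAt γ δ v
  extendAt-proper {γ} {δ} γ-proper shielded δ-proper {u} {v} adj with S? u | S? v
  ... | yes u∈S | yes v∈S = δ-proper _ _ adj′ ∘ palette-injective
    where
    adj′ : Adjacent G (V.embed (V.index u∈S)) (V.embed (V.index v∈S))
    adj′ = subst₂ (Adjacent G) (sym (V.embed∘index u∈S)) (sym (V.embed∘index v∈S)) adj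
  ... | yes u∈S | no v∉S =
    let (≢spare , ∉P) = shielded {u} {v} adj u∈S v∉S
    in palette-avoids ≢spare ∉P (lookup δ (V.index u∈S))
  ... | no u∉S | yes v∈S =
    let (≢spare , ∉P) = shielded {v} {u} (adjacent-sym G adj) v∈S u∉S
    in palette-avoids ≢spare ∉P (lookup δ (V.index v∈S)) ∘ sym
  ... | no _ | no _ = γ-proper u v adj

  extend-proper : ∀ {γ δ} → Proper G γ → Shielded γ → Proper H δ → Proper G (extend γ δ)
  extend-proper γ-proper shielded δ-proper u v adj eq =
    extendAt-proper γ-proper shielded δ-proper adj
      (trans (sym (lookup∘tabulate _ u)) (trans eq (lookup∘tabulate _ v)))

  extendAt-fixed : ∀ γ {δ δ′ i} → (∀ j → j ≢ i → lookup δ j ≡ lookup δ′ j) →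
                   ∀ v → v ≢ V.embed i → extendAt γ δ v ≡ extendAt γ δ′ v
  extendAt-fixed γ fixed v v≢i with S? v
  ... | yes v∈S =
    cong palette (fixed _ (λ eq → v≢i (trans (sym (V.embed∘index v∈S)) (cong V.embed eq))))
  ... | no  _   = refl

  extend-edge : ∀ {γ} → Proper G γ → Shielded γ →
                ∀ {δ δ′} → REdge H (suc C.size) δ δ′ → REdge G ℓ (extend γ δ) (extend γ δ′)
  extend-edge {γ} γ-proper shielded {δ} {δ′} (δ-proper , δ′-proper , i , changed , fixed) =
    extend-proper γ-proper shielded δ-proper , extend-proper γ-proper shielded δ′-proper ,
    V.embed i , changed′ , fixed′
    where
    changed′ : lookup (extend γ δ) (V.embed i) ≢ lookup (extend γ δ′) (V.embed i)
    changed′ eq = changed (palette-injective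
      (trans (sym (lookup-extend-embed γ δ i)) (trans eq (lookup-extend-embed γ δ′ i))))

    fixed′ : ∀ v → v ≢ V.embed i → lookup (extend γ δ) v ≡ lookup (extend γ δ′) v
    fixed′ v v≢i = trans (lookup∘tabulate _ v)
      (trans (extendAt-fixed γ fixed v v≢i) (sym (lookup∘tabulate _ v)))

  extend-restrict : ∀ {γ γ′} → (∀ v → ¬ S v → lookup γ v ≡ lookup γ′ v) →
                    (γ′∈P : PaletteOnS γ′) → extend γ (map suc (restrict γ′ γ′∈P)) ≡ γ′
  extend-restrict {γ} {γ′} agree γ′∈P = trans (tabulate-cong extendAt≗γ′) (tabulate∘lookup γ′)
    where
    open ≡-Reasoning
    extendAt≗γ′ : ∀ v → extendAt γ (map suc (restrict γ′ γ′∈P)) v ≡ lookup γ′ v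
    extendAt≗γ′ v with S? v
    ... | yes v∈S = begin
      palette (lookup (map suc (restrict γ′ γ′∈P)) (V.index v∈S))
        ≡⟨ cong palette (lookup-map (V.index v∈S) suc (restrict γ′ γ′∈P)) ⟩
      C.embed (lookup (restrict γ′ γ′∈P) (V.index v∈S))
        ≡⟨ embed-restrict γ′ γ′∈P (V.index v∈S) ⟩
      lookup γ′ (V.embed (V.index v∈S))
        ≡⟨ cong (lookup γ′) (V.embed∘index v∈S) ⟩
      lookup γ′ v ∎
    ... | no v∉S = agree v v∉S

  recolour-within : Recolourable H → ∀ {γ γ′} → Proper G γ → Proper G γ′ →
                    (γ∈P : PaletteOnS γ) (γ′∈P : PaletteOnS γ′) →
                    (∀ v → ¬ S v → lookup γ v ≡ lookup γ′ v) → Shielded γ → RPath G ℓ γ γ′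
  recolour-within H-recolourable {γ} {γ′} γ-proper γ′-proper γ∈P γ′∈P agree shielded
    with chromatic-number H (restrict γ γ∈P) (restrict-proper γ γ∈P γ-proper)
  ... | c , c≤size , c-chromatic =
    subst₂ (RPath G ℓ) (extend-restrict (λ _ _ → refl) γ∈P) (extend-restrict agree γ′∈P)
      (gmap (extend γ) (extend-edge γ-proper shielded)
        (H-recolourable c c-chromatic (suc C.size) (s≤s c≤size) _ _
          (map-proper H suc-injective (restrict γ γ∈P) (restrict-proper γ γ∈P γ-proper))
          (map-proper H suc-injective (restrict γ′ γ′∈P) (restrict-proper γ′ γ′∈P γ′-proper))))

<ᵇ-suc : ∀ {a j} → a ≢ j → (a <ᵇ j) ≡ (a <ᵇ suc j)
<ᵇ-suc {zero}  {zero}  a≢j = contradiction refl a≢j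
<ᵇ-suc {zero}  {suc j} _   = refl
<ᵇ-suc {suc a} {zero}  _   = refl
<ᵇ-suc {suc a} {suc j} a≢j = <ᵇ-suc (a≢j ∘ cong suc)

module Interpolation {n m} (part : Fin n → Fin m) {A : Set} where

  source : ℕ → Fin m → Vec A n → Vec A n → Vec A n
  source j p xs ys = if toℕ p <ᵇ j then ys else xs

  interpolate : ℕ → Vec A n → Vec A n → Vec A n
  interpolate j xs ys = tabulate λ v → lookup (source j (part v) xs ys) v

  lookup-interpolate : ∀ j xs ys v →
                       lookup (interpolate j xs ys) v ≡ lookup (source j (part v) xs ys) v
  lookup-interpolate j xs ys = lookup∘tabulate _

  interpolate-zero : ∀ xs ys → interpolate 0 xs ys ≡ xs
  interpolate-zero xs ys = tabulate∘lookup xs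

  interpolate-all : ∀ xs ys → interpolate m xs ys ≡ ys
  interpolate-all xs ys = trans (tabulate-cong from-ys) (tabulate∘lookup ys)
    where
    from-ys : ∀ v → lookup (source m (part v) xs ys) v ≡ lookup ys v
    from-ys v rewrite Equivalence.to T-≡ (<⇒<ᵇ (toℕ<n (part v))) = refl

  interpolate-suc : ∀ {j} (j<m : j < m) xs ys v → part v ≢ fromℕ< j<m →
                    lookup (interpolate j xs ys) v ≡ lookup (interpolate (suc j) xs ys) v
  interpolate-suc {j} j<m xs ys v v∉j = begin
    lookup (interpolate j xs ys) v
      ≡⟨ lookup-interpolate j xs ys v ⟩
    lookup (source j (part v) xs ys) v
      ≡⟨ cong (λ b → lookup (if b then ys else xs) v) (<ᵇ-suc toℕ≢j) ⟩
    lookup (source (suc j) (part v) xs ys) v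
      ≡⟨ lookup-interpolate (suc j) xs ys v ⟨
    lookup (interpolate (suc j) xs ys) v
      ∎
    where
    open ≡-Reasoning
    toℕ≢j : toℕ (part v) ≢ j
    toℕ≢j eq = v∉j (toℕ-injective (trans eq (sym (toℕ-fromℕ< j<m))))

module Blocks {n m ℓ} (G : Graph n) (part : Fin n → Fin m)
  (block-module : ∀ p → IsModule G (Block part p))
  (block-proper : ∀ p → ProperSubset (Block part p))
  (induced-recolourable : ProperInducedRecolourable G)
  (β : Colouring n ℓ) (β-proper : Proper G β)
  (spare : Fin ℓ) (β≢spare : ∀ v → lookup β v ≢ spare) where

  Palette : Fin m → Pred (Fin ℓ) 0ℓ
  Palette p x = ∃ λ u → part u ≡ p × lookup β u ≡ x

  palette? : ∀ p → Decidable (Palette p)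
  palette? p x = any? λ u → (part u ≟ p) ×-dec (lookup β u ≟ x)

  spare∉palette : ∀ p → ¬ Palette p spare
  spare∉palette p (u , _ , eq) = β≢spare u eq

  palettes-disjoint : ∀ {u v x} → Adjacent G u v → part u ≢ part v →
                      Palette (part u) x → ¬ Palette (part v) x
  palettes-disjoint {u} {v} adj u≁v (u′ , u′∈ , refl) (v′ , v′∈ , eq) =
    β-proper u′ v′ joined (sym eq)
    where
    joined : Adjacent G u′ v′
    joined = disjoint-modules-joined G (block-module (part u)) (block-module (part v))
      (λ x∈u x∈v → u≁v (trans (sym x∈u) x∈v)) refl refl adj u′∈ v′∈

  Compatible : Colouring n ℓ → Set
  Compatible γ = Proper G γ × (∀ v → Palette (part v) (lookup γ v))

  block-step : ∀ p {γ δ} → Compatible γ → Compatible δ →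
               (∀ v → part v ≢ p → lookup γ v ≡ lookup δ v) → RPath G ℓ γ δ
  block-step p {γ} {δ} (γ-proper , γ∈) (δ-proper , δ∈) agree =
    recolour-within recolourable γ-proper δ-proper (in-block γ γ∈) (in-block δ δ∈) agree shielded
    where
    open Recolouring G (λ v → part v ≟ p) (palette? p) spare (spare∉palette p)

    recolourable : Recolourable H
    recolourable = induced-recolourable V.size (size< vertices (proj₂ (block-proper p)))
      V.embed V.embed-injective

    in-block : ∀ γ → (∀ v → Palette (part v) (lookup γ v)) → PaletteOnS γ
    in-block _ γ∈ {v} v∈p = subst (λ q → Palette q _) v∈p (γ∈ v)

    shielded : Shielded γ
    shielded {u} {v} adj u∈p v∉p =
      (λ eq → spare∉palette (part v) (subst (Palette (part v)) eq (γ∈ v))) ,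
      (λ γv∈p → palettes-disjoint adj (λ eq → v∉p (trans (sym eq) u∈p))
                  (subst (λ q → Palette q (lookup γ v)) (sym u∈p) γv∈p) (γ∈ v))

  open Interpolation part

  source-compatible : ∀ {γ δ} → Compatible γ → Compatible δ → ∀ j p → Compatible (source j p γ δ)
  source-compatible γ-compatible δ-compatible j p with toℕ p <ᵇ j
  ... | true  = δ-compatible
  ... | false = γ-compatible

  interpolate-compatible : ∀ {γ δ} → Compatible γ → Compatible δ →
                           ∀ j → Compatible (interpolate j γ δ)
  interpolate-compatible {γ} {δ} γ-compatible δ-compatible j = proper , in-palette
    where
    open ≡-Reasoning
    I = interpolate j γ δ
    compatible = source-compatible γ-compatible δ-compatible j

    in-palette : ∀ v → Palette (part v) (lookup I v)
    in-palette v = subst (Palette (part v)) (sym (lookup-interpolate j γ δ v))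
                     (proj₂ (compatible (part v)) v)

    proper : Proper G I
    proper u v adj eq with part u ≟ part v
    ... | yes same = proj₁ (compatible (part u)) u v adj (begin
      lookup (source j (part u) γ δ) u   ≡⟨ lookup-interpolate j γ δ u ⟨
      lookup I u                         ≡⟨ eq ⟩
      lookup I v                         ≡⟨ lookup-interpolate j γ δ v ⟩
      lookup (source j (part v) γ δ) v   ≡⟨ cong (λ p → lookup (source j p γ δ) v) same ⟨
      lookup (source j (part u) γ δ) v   ∎)
    ... | no differ =
      palettes-disjoint adj differ (in-palette u) (subst (Palette (part v)) (sym eq) (in-palette v))

  compatible-path : ∀ {γ δ} → Compatible γ → Compatible δ → RPath G ℓ γ δ
  compatible-path {γ} {δ} γ-compatible δ-compatible =
    subst₂ (RPath G ℓ) (interpolate-zero γ δ) (interpolate-all γ δ) (path-to m ≤-refl)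
    where
    path-to : ∀ j → j ≤ m → RPath G ℓ (interpolate 0 γ δ) (interpolate j γ δ)
    path-to zero    _   = ε
    path-to (suc j) j<m = path-to j (<⇒≤ j<m) ◅◅
      block-step (fromℕ< j<m) (interpolate-compatible γ-compatible δ-compatible j)
        (interpolate-compatible γ-compatible δ-compatible (suc j)) (interpolate-suc j<m γ δ)

lemma2 : ∀ {n m} (G : Graph n) (part : Fin n → Fin m) →
    (∀ p → IsMaximalModule G (Block part p)) →
    ProperInducedRecolourable G →
    (c : ℕ) → IsChromatic G c →
    (α β : Colouring n c) → Proper G α → Proper G β →
    (∀ p v → part v ≡ p → ∃ λ u → part u ≡ p × lookup β u ≡ lookup α v) →
    ∀ ℓ → (h : suc c ≤ ℓ) → RPath G ℓ (lift (<⇒≤ h) α) (lift (<⇒≤ h) β)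
lemma2 G part maximal induced-recolourable c _ α β α-proper β-proper α⊆β ℓ c<ℓ =
  compatible-path (lift-proper G c≤ℓ α α-proper , α∈)
                  (lift-proper G c≤ℓ β β-proper , λ v → v , refl , refl)
  where
  c≤ℓ = <⇒≤ c<ℓ

  open Blocks G part (proj₁ ∘ maximal) (proj₁ ∘ proj₂ ∘ maximal) induced-recolourable
    (lift c≤ℓ β) (lift-proper G c≤ℓ β β-proper) (fromℕ< c<ℓ) (lift-avoids-top c<ℓ β)

  α∈ : ∀ v → Palette (part v) (lookup (lift c≤ℓ α) v)
  α∈ v with α⊆β (part v) v refl
  ... | u , u∈ , βu≡αv = u , u∈ , (begin
    lookup (lift c≤ℓ β) u        ≡⟨ lookup-lift c≤ℓ β u ⟩
    inject≤ (lookup β u) c≤ℓ     ≡⟨ cong (λ i → inject≤ i c≤ℓ) βu≡αv ⟩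
    inject≤ (lookup α v) c≤ℓ     ≡⟨ lookup-lift c≤ℓ α v ⟨
    lookup (lift c≤ℓ α) v        ∎)
    where open ≡-Reasoning
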